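{- Let $T=(T_a,T_b)$ be a rooted binary tree with $n$ leaves, where $T_a$ and $T_b$ have $n_a$ and $n_b$ leaves respectively. If $n_a\ne n_b$ and both $n_a$ and $n_b$ are odd, then $\mathcal{C}(T)>c_n$, i.e. $T$ does not have minimal Colless index.
   Context: A rooted binary tree with $n\ge2$ leaves is a rooted tree in which the root has degree 2 and every other internal vertex has degree 3 (each internal vertex has exactly two children); the single vertex is the rooted binary tree with one leaf. $T=(T_a,T_b)$ denotes the decomposition into the subtrees rooted at the two children of the root. For a vertex $v$, $\kappa_T(v)$ is the number of leaves descending from $v$ ($1$ if $v$ is a leaf). For an internal vertex $v$ with children $v_1,v_2$, $bal_T(v)=|\kappa_T(v_1)-\kappa_T(v_2)|$, and the Colless index is $\mathcal{C}(T)=\sum_{v\text{ internal}} bal_T(v)$; $c_n$ denotes its minimum over all rooted binary trees with $n$ leaves. -}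

module Defs where

open import Data.Nat using (ℕ; _+_; _∸_; _≤_)
open import Data.Product using (Σ; _×_)
open import Relation.Binary.PropositionalEquality using (_≡_)

data Tree : Set where
  leaf : Tree
  node : Tree → Tree → Tree

leaves : Tree → ℕ
leaves leaf       = 1
leaves (node a b) = leaves a + leaves b

absDiff : ℕ → ℕ → ℕ
absDiff m n = (m ∸ n) + (n ∸ m)

colless : Tree → ℕ
colless leaf       = 0
colless (node a b) = absDiff (leaves a) (leaves b) + colless a + colless b

IsMinColless : ℕ → ℕ → Set
IsMinColless n c =
  Σ Tree (λ T → (leaves T ≡ n) × (colless T ≡ c))
  × ((T : Tree) → leaves T ≡ n → c ≤ colless T)

-- Let c(n) be the Colless index of the maximally balanced tree, which splits n leaves into
-- ⌊n/2⌋ and ⌈n/2⌉ at every vertex: c(1) = 0 and c(n) = (n mod 2) + c(⌊n/2⌋) + c(⌈n/2⌉).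
-- A case analysis on the parities of x and y, by induction along this recurrence, gives
-- c(x + y) ≤ |x − y| + c(x) + c(y); hence c(κ(T)) ≤ 𝒞(T) for every tree T, so c(n) = c_n.
-- For distinct odd x and y the inequality is strict, so a root split into two distinct odd
-- parts already costs more than c_n.

module Submission where

open import Defs
open import Data.Nat using (ℕ; _<_; _%_)
open import Relation.Binary.PropositionalEquality using (_≡_; _≢_)

open import Data.Nat using (zero; suc; _+_; _*_; _∸_; _≤_; z≤n; s≤s; s≤s⁻¹; ⌊_/2⌋; ⌈_/2⌉)
open import Data.Nat.Properties
open import Algebra.Properties.CommutativeSemigroup +-commutativeSemigroup using (interchange; xy∙z≈xz∙y)
open import Data.Nat.DivMod using ([m+kn]%n≡m%n)
open import Data.Nat.Tactic.RingSolver using (solve)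
open import Data.List using (_∷_; [])
open import Data.Product using (_,_)
open import Data.Sum using (inj₁; inj₂)
open import Data.Empty using (⊥-elim)
open import Relation.Binary.PropositionalEquality using (refl; sym; trans; cong; cong₂; subst; subst₂; module ≡-Reasoning)
open import Relation.Binary using (tri<; tri≈; tri>)

data EvenOdd : ℕ → Set where
  even : ∀ p → EvenOdd (p + p)
  odd  : ∀ p → EvenOdd (suc (p + p))

evenOdd : ∀ n → EvenOdd n
evenOdd zero = even 0
evenOdd (suc n) with evenOdd n
... | even p = odd p
... | odd p  = subst EvenOdd (cong suc (+-suc p p)) (even (suc p))

even≤even⇒≤ : ∀ {p q} → p + p ≤ q + q → p ≤ q
even≤even⇒≤ {p} {q} h = subst₂ _≤_ (sym (n≡⌊n+n/2⌋ p)) (sym (n≡⌊n+n/2⌋ q)) (⌊n/2⌋-mono h)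

even≤odd⇒≤ : ∀ {p q} → p + p ≤ suc (q + q) → p ≤ q
even≤odd⇒≤ {p} {q} h = subst₂ _≤_ (sym (n≡⌊n+n/2⌋ p)) (sym (n≡⌈n+n/2⌉ q)) (⌊n/2⌋-mono h)

odd≤even⇒< : ∀ {p q} → suc (p + p) ≤ q + q → p < q
odd≤even⇒< {p} {q} h = subst₂ (λ a b → suc a ≤ b) (sym (n≡⌊n+n/2⌋ p)) (sym (n≡⌈n+n/2⌉ q)) (⌈n/2⌉-mono h)

odd≤odd⇒≤ : ∀ {p q} → suc (p + p) ≤ suc (q + q) → p ≤ q
odd≤odd⇒≤ h = even≤even⇒≤ (s≤s⁻¹ h)

odd-mono-≤ : ∀ {p q} → p ≤ q → suc (p + p) ≤ suc (q + q)
odd-mono-≤ p≤q = s≤s (+-mono-≤ p≤q p≤q)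

even+even : ∀ p q → (p + p) + (q + q) ≡ (p + q) + (p + q)
even+even p q = interchange p p q q

odd+odd : ∀ p q → suc (p + p) + suc (q + q) ≡ suc (p + q) + suc (p + q)
odd+odd p q = solve (p ∷ q ∷ [])

even%2 : ∀ p → (p + p) % 2 ≡ 0
even%2 p = trans (cong (_% 2) double≡*2) ([m+kn]%n≡m%n 0 p 2)
  where
  double≡*2 : p + p ≡ 0 + p * 2
  double≡*2 = solve (p ∷ [])

absDiff-self : ∀ p → absDiff p p ≡ 0
absDiff-self p = cong₂ _+_ (n∸n≡0 p) (n∸n≡0 p)

absDiff-suc : ∀ p → absDiff p (suc p) ≡ 1
absDiff-suc zero    = refl
absDiff-suc (suc p) = absDiff-suc p

absDiff-comm : ∀ x y → absDiff x y ≡ absDiff y x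
absDiff-comm x y = +-comm (x ∸ y) (y ∸ x)

-- The first argument bounds the recursion depth; the value is c_n once n ≤ k.
minColless : ℕ → ℕ → ℕ
minColless zero    _ = 0
minColless (suc k) 0 = 0
minColless (suc k) 1 = 0
minColless (suc k) n@(suc (suc _)) =
  absDiff ⌊ n /2⌋ ⌈ n /2⌉ + minColless k ⌊ n /2⌋ + minColless k ⌈ n /2⌉

minColless-0 : ∀ k → minColless k 0 ≡ 0
minColless-0 zero    = refl
minColless-0 (suc k) = refl

minColless-1 : ∀ k → minColless k 1 ≡ 0
minColless-1 zero    = refl
minColless-1 (suc k) = refl

minColless-unfold : ∀ k {n} → 2 ≤ n →
  minColless (suc k) n ≡ absDiff ⌊ n /2⌋ ⌈ n /2⌉ + minColless k ⌊ n /2⌋ + minColless k ⌈ n /2⌉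
minColless-unfold k (s≤s (s≤s _)) = refl

minColless-double : ∀ k p → minColless (suc k) (p + p) ≡ minColless k p + minColless k p
minColless-double k zero = sym (cong₂ _+_ (minColless-0 k) (minColless-0 k))
minColless-double k p@(suc _) = begin
  minColless (suc k) (p + p)
    ≡⟨ minColless-unfold k (+-mono-≤ (s≤s z≤n) (s≤s z≤n)) ⟩
  absDiff ⌊ p + p /2⌋ ⌈ p + p /2⌉ + minColless k ⌊ p + p /2⌋ + minColless k ⌈ p + p /2⌉
    ≡⟨ cong₂ (λ a b → absDiff a b + minColless k a + minColless k b) (sym (n≡⌊n+n/2⌋ p)) (sym (n≡⌈n+n/2⌉ p)) ⟩
  absDiff p p + minColless k p + minColless k p
    ≡⟨ cong (λ d → d + minColless k p + minColless k p) (absDiff-self p) ⟩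
  minColless k p + minColless k p ∎
  where open ≡-Reasoning

minColless-odd : ∀ k {p} → 1 ≤ p →
  minColless (suc k) (suc (p + p)) ≡ minColless k p + minColless k (suc p) + 1
minColless-odd k {p} 1≤p = begin
  minColless (suc k) (suc (p + p))
    ≡⟨ minColless-unfold k (s≤s (≤-trans 1≤p (m≤m+n p p))) ⟩
  absDiff ⌈ p + p /2⌉ (suc ⌊ p + p /2⌋) + minColless k ⌈ p + p /2⌉ + minColless k (suc ⌊ p + p /2⌋)
    ≡⟨ cong₂ (λ a b → absDiff a (suc b) + minColless k a + minColless k (suc b)) (sym (n≡⌈n+n/2⌉ p)) (sym (n≡⌊n+n/2⌋ p)) ⟩
  absDiff p (suc p) + minColless k p + minColless k (suc p)
    ≡⟨ cong (λ d → d + minColless k p + minColless k (suc p)) (absDiff-suc p) ⟩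
  1 + minColless k p + minColless k (suc p)
    ≡⟨ +-comm 1 _ ⟩
  minColless k p + minColless k (suc p) + 1 ∎
  where open ≡-Reasoning

even-even-step : ∀ {G p q A B} → G + p ≤ q + A + B →
  (G + G) + (p + p) ≤ (q + q) + (A + A) + (B + B)
even-even-step {G} {p} {q} {A} {B} h = begin
  (G + G) + (p + p)            ≡⟨ interchange G G p p ⟩
  (G + p) + (G + p)            ≤⟨ +-mono-≤ h h ⟩
  (q + A + B) + (q + A + B)    ≡⟨ solve (q ∷ A ∷ B ∷ []) ⟩
  (q + q) + (A + A) + (B + B)  ∎
  where open ≤-Reasoning

even-odd-step : ∀ {G₁ G₂ p q A B₁ B₂} → G₁ + p ≤ q + A + B₁ → G₂ + p ≤ suc q + A + B₂ →
  (G₁ + G₂ + 1) + (p + p) ≤ suc (q + q) + (A + A) + (B₁ + B₂ + 1)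
even-odd-step {G₁} {G₂} {p} {q} {A} {B₁} {B₂} h₁ h₂ = begin
  (G₁ + G₂ + 1) + (p + p)                  ≡⟨ solve (G₁ ∷ G₂ ∷ p ∷ []) ⟩
  (G₁ + p) + (G₂ + p) + 1                  ≤⟨ +-monoˡ-≤ 1 (+-mono-≤ h₁ h₂) ⟩
  (q + A + B₁) + (suc q + A + B₂) + 1      ≡⟨ solve (q ∷ A ∷ B₁ ∷ B₂ ∷ []) ⟩
  suc (q + q) + (A + A) + (B₁ + B₂ + 1)    ∎
  where open ≤-Reasoning

odd-even-step : ∀ {G₁ G₂ p q A₁ A₂ B} → G₁ + p ≤ q + A₁ + B → G₂ + suc p ≤ q + A₂ + B →
  (G₁ + G₂ + 1) + suc (p + p) ≤ (q + q) + (A₁ + A₂ + 1) + (B + B)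
odd-even-step {G₁} {G₂} {p} {q} {A₁} {A₂} {B} h₁ h₂ = begin
  (G₁ + G₂ + 1) + suc (p + p)              ≡⟨ solve (G₁ ∷ G₂ ∷ p ∷ []) ⟩
  (G₁ + p) + (G₂ + suc p) + 1              ≤⟨ +-monoˡ-≤ 1 (+-mono-≤ h₁ h₂) ⟩
  (q + A₁ + B) + (q + A₂ + B) + 1          ≡⟨ solve (q ∷ A₁ ∷ A₂ ∷ B ∷ []) ⟩
  (q + q) + (A₁ + A₂ + 1) + (B + B)        ∎
  where open ≤-Reasoning

one-even-step : ∀ {G q B} → G + 1 ≤ q + B → 1 ≤ q →
  (B + G + 1) + 1 ≤ (q + q) + 0 + (B + B)
one-even-step {G} {q} {B} h 1≤q = begin
  (B + G + 1) + 1              ≡⟨ solve (B ∷ G ∷ []) ⟩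
  (G + 1) + (B + 1)            ≤⟨ +-mono-≤ h (+-monoʳ-≤ B 1≤q) ⟩
  (q + B) + (B + q)            ≡⟨ solve (q ∷ B ∷ []) ⟩
  (q + q) + 0 + (B + B)        ∎
  where open ≤-Reasoning

odd-odd-step : ∀ {G p q A₁ A₂ B₁ B₂} → G + p ≤ suc q + A₁ + B₂ → G + suc p ≤ q + A₂ + B₁ →
  suc (G + G) + suc (p + p) ≤ suc (q + q) + (A₁ + A₂ + 1) + (B₁ + B₂ + 1)
odd-odd-step {G} {p} {q} {A₁} {A₂} {B₁} {B₂} h₁ h₂ = begin
  suc (G + G) + suc (p + p)                        ≡⟨ solve (G ∷ p ∷ []) ⟩
  (G + p) + (G + suc p) + 1                        ≤⟨ +-monoˡ-≤ 1 (+-mono-≤ h₁ h₂) ⟩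
  (suc q + A₁ + B₂) + (q + A₂ + B₁) + 1            ≤⟨ n≤1+n _ ⟩
  suc ((suc q + A₁ + B₂) + (q + A₂ + B₁) + 1)      ≡⟨ solve (q ∷ A₁ ∷ A₂ ∷ B₁ ∷ B₂ ∷ []) ⟩
  suc (q + q) + (A₁ + A₂ + 1) + (B₁ + B₂ + 1)      ∎
  where open ≤-Reasoning

one-odd-step : ∀ {G q B} → G + 1 ≤ q + B →
  suc (G + G) + 1 ≤ suc (q + q) + 0 + (B + G + 1)
one-odd-step {G} {q} {B} h = begin
  suc (G + G) + 1                  ≡⟨ solve (G ∷ []) ⟩
  (G + 1) + (G + 1)                ≤⟨ +-monoˡ-≤ (G + 1) h ⟩
  (q + B) + (G + 1)                ≤⟨ m≤m+n _ (suc q) ⟩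
  (q + B) + (G + 1) + suc q        ≡⟨ solve (q ∷ B ∷ G ∷ []) ⟩
  suc (q + q) + 0 + (B + G + 1)    ∎
  where open ≤-Reasoning

odd-self-step : ∀ {G p A B} → G + p ≤ suc p + A + B →
  (G + G) + suc (p + p) ≤ suc (p + p) + (A + B + 1) + (A + B + 1)
odd-self-step {G} {p} {A} {B} h = begin
  (G + G) + suc (p + p)                      ≡⟨ solve (G ∷ p ∷ []) ⟩
  (G + p) + (G + p) + 1                      ≤⟨ +-monoˡ-≤ 1 (+-mono-≤ h h) ⟩
  (suc p + A + B) + (suc p + A + B) + 1      ≡⟨ solve (p ∷ A ∷ B ∷ []) ⟩
  suc (p + p) + (A + B + 1) + (A + B + 1)    ∎
  where open ≤-Reasoning

-- c(x + y) ≤ (y − x) + c(x) + c(y), with the subtraction moved to the left.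
SplitBound : ℕ → Set
SplitBound k = ∀ {x y} → x ≤ y → minColless k (x + y) + x ≤ y + minColless k x + minColless k y

module SplitStep {k} (ih : SplitBound k) where
  open ≤-Reasoning

  private
    c c′ : ℕ → ℕ
    c  = minColless k
    c′ = minColless (suc k)

  split-bound-suc : ∀ {p q} → p ≤ q → c (suc (p + q)) + p ≤ suc q + c p + c (suc q)
  split-bound-suc {p} {q} p≤q = subst (λ n → c n + p ≤ suc q + c p + c (suc q)) (+-suc p q) (ih (m≤n⇒m≤1+n p≤q))

  -- x = 1 needs this separately: c(1) = 0, not the 1 that the odd recurrence would give.
  split-bound-one : ∀ {q} → 1 ≤ q → c (suc q) + 1 ≤ q + c q
  split-bound-one {q} 1≤q = begin
    c (suc q) + 1    ≤⟨ ih 1≤q ⟩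
    q + c 1 + c q    ≡⟨ cong (λ z → q + z + c q) (minColless-1 k) ⟩
    q + 0 + c q      ≡⟨ cong (_+ c q) (+-identityʳ q) ⟩
    q + c q          ∎

  split-even-even : ∀ {p q} → p ≤ q →
    c′ ((p + p) + (q + q)) + (p + p) ≤ (q + q) + c′ (p + p) + c′ (q + q)
  split-even-even {p} {q} p≤q = begin
    c′ ((p + p) + (q + q)) + (p + p)
      ≡⟨ cong (λ n → c′ n + (p + p)) (even+even p q) ⟩
    c′ ((p + q) + (p + q)) + (p + p)
      ≡⟨ cong (_+ (p + p)) (minColless-double k (p + q)) ⟩
    (c (p + q) + c (p + q)) + (p + p)
      ≤⟨ even-even-step {G = c (p + q)} {q = q} (ih p≤q) ⟩
    (q + q) + (c p + c p) + (c q + c q)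
      ≡⟨ sym (cong₂ (λ a b → (q + q) + a + b) (minColless-double k p) (minColless-double k q)) ⟩
    (q + q) + c′ (p + p) + c′ (q + q) ∎

  split-even-odd : ∀ {p q} → 1 ≤ p → p ≤ q →
    c′ ((p + p) + suc (q + q)) + (p + p) ≤ suc (q + q) + c′ (p + p) + c′ (suc (q + q))
  split-even-odd {p} {q} 1≤p p≤q = begin
    c′ ((p + p) + suc (q + q)) + (p + p)
      ≡⟨ cong (λ n → c′ n + (p + p)) (trans (+-suc (p + p) (q + q)) (cong suc (even+even p q))) ⟩
    c′ (suc ((p + q) + (p + q))) + (p + p)
      ≡⟨ cong (_+ (p + p)) (minColless-odd k (≤-trans 1≤p (m≤m+n p q))) ⟩
    (c (p + q) + c (suc (p + q)) + 1) + (p + p)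
      ≤⟨ even-odd-step {G₁ = c (p + q)} {G₂ = c (suc (p + q))} {q = q} (ih p≤q) (split-bound-suc p≤q) ⟩
    suc (q + q) + (c p + c p) + (c q + c (suc q) + 1)
      ≡⟨ sym (cong₂ (λ a b → suc (q + q) + a + b) (minColless-double k p) (minColless-odd k (≤-trans 1≤p p≤q))) ⟩
    suc (q + q) + c′ (p + p) + c′ (suc (q + q)) ∎

  split-odd-even : ∀ {p q} → p < q →
    c′ (suc (p + p) + (q + q)) + suc (p + p) ≤ (q + q) + c′ (suc (p + p)) + c′ (q + q)
  split-odd-even {zero} {q} 1≤q = begin
    c′ (suc (q + q)) + 1
      ≡⟨ cong (_+ 1) (minColless-odd k 1≤q) ⟩
    (c q + c (suc q) + 1) + 1
      ≤⟨ one-even-step {G = c (suc q)} {q = q} (split-bound-one 1≤q) 1≤q ⟩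
    (q + q) + 0 + (c q + c q)
      ≡⟨ sym (cong ((q + q) + 0 +_) (minColless-double k q)) ⟩
    (q + q) + 0 + c′ (q + q) ∎
  split-odd-even {p@(suc _)} {q} p<q = begin
    c′ (suc (p + p) + (q + q)) + suc (p + p)
      ≡⟨ cong (λ n → c′ (suc n) + suc (p + p)) (even+even p q) ⟩
    c′ (suc ((p + q) + (p + q))) + suc (p + p)
      ≡⟨ cong (_+ suc (p + p)) (minColless-odd k (s≤s z≤n)) ⟩
    (c (p + q) + c (suc (p + q)) + 1) + suc (p + p)
      ≤⟨ odd-even-step {G₁ = c (p + q)} {G₂ = c (suc (p + q))} {q = q} (ih (<⇒≤ p<q)) (ih p<q) ⟩
    (q + q) + (c p + c (suc p) + 1) + (c q + c q)
      ≡⟨ sym (cong₂ (λ a b → (q + q) + a + b) (minColless-odd k (s≤s z≤n)) (minColless-double k q)) ⟩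
    (q + q) + c′ (suc (p + p)) + c′ (q + q) ∎

  split-odd-odd : ∀ {p q} → p < q →
    suc (c′ (suc (p + p) + suc (q + q))) + suc (p + p) ≤ suc (q + q) + c′ (suc (p + p)) + c′ (suc (q + q))
  split-odd-odd {zero} {q} 1≤q = begin
    suc (c′ (suc (suc (q + q)))) + 1
      ≡⟨ cong (λ n → suc (c′ n) + 1) (odd+odd 0 q) ⟩
    suc (c′ (suc q + suc q)) + 1
      ≡⟨ cong (λ n → suc n + 1) (minColless-double k (suc q)) ⟩
    suc (c (suc q) + c (suc q)) + 1
      ≤⟨ one-odd-step {G = c (suc q)} {q = q} (split-bound-one 1≤q) ⟩
    suc (q + q) + 0 + (c q + c (suc q) + 1)
      ≡⟨ sym (cong (suc (q + q) + 0 +_) (minColless-odd k 1≤q)) ⟩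
    suc (q + q) + 0 + c′ (suc (q + q)) ∎
  split-odd-odd {p@(suc _)} {q} p<q = begin
    suc (c′ (suc (p + p) + suc (q + q))) + suc (p + p)
      ≡⟨ cong (λ n → suc (c′ n) + suc (p + p)) (odd+odd p q) ⟩
    suc (c′ (suc (p + q) + suc (p + q))) + suc (p + p)
      ≡⟨ cong (λ n → suc n + suc (p + p)) (minColless-double k (suc (p + q))) ⟩
    suc (c (suc (p + q)) + c (suc (p + q))) + suc (p + p)
      ≤⟨ odd-odd-step {G = c (suc (p + q))} {q = q} (split-bound-suc (<⇒≤ p<q)) (ih p<q) ⟩
    suc (q + q) + (c p + c (suc p) + 1) + (c q + c (suc q) + 1)
      ≡⟨ sym (cong₂ (λ a b → suc (q + q) + a + b) (minColless-odd k (s≤s z≤n)) (minColless-odd k (≤-trans (s≤s z≤n) (<⇒≤ p<q)))) ⟩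
    suc (q + q) + c′ (suc (p + p)) + c′ (suc (q + q)) ∎

  split-odd-self : ∀ p →
    c′ (suc (p + p) + suc (p + p)) + suc (p + p) ≤ suc (p + p) + c′ (suc (p + p)) + c′ (suc (p + p))
  split-odd-self zero = ≤-reflexive (cong (λ n → n + n + 1) (minColless-1 k))
  split-odd-self p@(suc _) = begin
    c′ (suc (p + p) + suc (p + p)) + suc (p + p)
      ≡⟨ cong (_+ suc (p + p)) (minColless-double k (suc (p + p))) ⟩
    (c (suc (p + p)) + c (suc (p + p))) + suc (p + p)
      ≤⟨ odd-self-step {G = c (suc (p + p))} {p = p} (split-bound-suc ≤-refl) ⟩
    suc (p + p) + (c p + c (suc p) + 1) + (c p + c (suc p) + 1)
      ≡⟨ sym (cong (λ a → suc (p + p) + a + a) (minColless-odd k (s≤s z≤n))) ⟩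
    suc (p + p) + c′ (suc (p + p)) + c′ (suc (p + p)) ∎

open SplitStep using (split-even-even; split-even-odd; split-odd-even; split-odd-odd; split-odd-self)

split-bound : ∀ k → SplitBound k
split-bound zero {x} {y} x≤y = subst (x ≤_) (sym (+-identityʳ (y + 0))) (m≤n⇒m≤n+o 0 x≤y)
split-bound (suc k) {x} {y} x≤y with evenOdd x | evenOdd y
... | even zero    | _      = ≤-trans (≤-reflexive (+-identityʳ _)) (m≤n+m _ (y + 0))
... | even (suc p) | even q = split-even-even (split-bound k) (even≤even⇒≤ {suc p} {q} x≤y)
... | even (suc p) | odd q  = split-even-odd (split-bound k) (s≤s z≤n) (even≤odd⇒≤ {suc p} {q} x≤y)
... | odd p        | even q = split-odd-even (split-bound k) (odd≤even⇒< {p} {q} x≤y)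
... | odd p        | odd q  with m≤n⇒m<n∨m≡n (odd≤odd⇒≤ {p} {q} x≤y)
...   | inj₁ p<q  = ≤-trans (n≤1+n _) (split-odd-odd (split-bound k) p<q)
...   | inj₂ refl = split-odd-self (split-bound k) p

≤-absDiff : ∀ {G x y X Y} → x ≤ y → G + x ≤ y + X + Y → G ≤ absDiff x y + X + Y
≤-absDiff {G} {x} {y} {X} {Y} x≤y h = +-cancelʳ-≤ x G (absDiff x y + X + Y) (begin
  G + x                          ≤⟨ h ⟩
  y + X + Y                      ≡⟨ cong (λ z → z + X + Y) (sym (m∸n+n≡m x≤y)) ⟩
  (y ∸ x) + x + X + Y            ≡⟨ shift (y ∸ x) ⟩
  (0 + (y ∸ x) + X + Y) + x      ≡⟨ cong (λ z → (z + (y ∸ x) + X + Y) + x) (sym (m≤n⇒m∸n≡0 x≤y)) ⟩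
  (absDiff x y + X + Y) + x      ∎)
  where
  open ≤-Reasoning
  shift : ∀ d → d + x + X + Y ≡ (d + X + Y) + x
  shift d = solve (d ∷ x ∷ X ∷ Y ∷ [])

≤-absDiff-swap : ∀ {G x y X Y} → y ≤ x → G + y ≤ x + Y + X → G ≤ absDiff x y + X + Y
≤-absDiff-swap {G} {x} {y} {X} {Y} y≤x h = begin
  G                          ≤⟨ ≤-absDiff y≤x h ⟩
  absDiff y x + Y + X        ≡⟨ xy∙z≈xz∙y (absDiff y x) Y X ⟩
  absDiff y x + X + Y        ≡⟨ cong (λ d → d + X + Y) (absDiff-comm y x) ⟩
  absDiff x y + X + Y        ∎
  where open ≤-Reasoning

minColless-split : ∀ k x y → minColless k (x + y) ≤ absDiff x y + minColless k x + minColless k y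
minColless-split k x y with ≤-total x y
... | inj₁ x≤y = ≤-absDiff x≤y (split-bound k x≤y)
... | inj₂ y≤x = ≤-absDiff-swap y≤x (subst (λ n → minColless k n + y ≤ x + minColless k y + minColless k x) (+-comm y x) (split-bound k y≤x))

minColless≤colless : ∀ k T → minColless k (leaves T) ≤ colless T
minColless≤colless k leaf       = ≤-reflexive (minColless-1 k)
minColless≤colless k (node a b) = ≤-trans (minColless-split k (leaves a) (leaves b))
  (+-mono-≤ (+-monoʳ-≤ (absDiff (leaves a) (leaves b)) (minColless≤colless k a)) (minColless≤colless k b))

minColless-odd-split : ∀ k {x y} → x ≢ y → x % 2 ≡ 1 → y % 2 ≡ 1 →
  minColless (suc k) (x + y) < absDiff x y + minColless (suc k) x + minColless (suc k) y
minColless-odd-split k {x} {y} x≢y x-odd y-odd with evenOdd x | evenOdd y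
... | even p | _      = ⊥-elim (0≢1+n (trans (sym (even%2 p)) x-odd))
... | odd p  | even q = ⊥-elim (0≢1+n (trans (sym (even%2 q)) y-odd))
... | odd p  | odd q  with <-cmp p q
...   | tri< p<q _ _  = ≤-absDiff (odd-mono-≤ (<⇒≤ p<q)) (split-odd-odd (split-bound k) p<q)
...   | tri≈ _ refl _ = ⊥-elim (x≢y refl)
...   | tri> _ _ q<p  = ≤-absDiff-swap (odd-mono-≤ (<⇒≤ q<p))
        (subst (λ n → suc (c′ n) + y ≤ x + c′ y + c′ x) (+-comm y x) (split-odd-odd (split-bound k) q<p))
  where c′ = minColless (suc k)

balanced : ℕ → ℕ → Tree
balanced zero    _ = leaf
balanced (suc k) 0 = leaf
balanced (suc k) 1 = leaf
balanced (suc k) n@(suc (suc _)) = node (balanced k ⌊ n /2⌋) (balanced k ⌈ n /2⌉)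

⌈n/2⌉≤pred : ∀ {m k} → suc (suc m) ≤ suc k → ⌈ suc (suc m) /2⌉ ≤ k
⌈n/2⌉≤pred {m} n≤1+k = s≤s⁻¹ (≤-trans (⌈n/2⌉<n m) n≤1+k)

⌊n/2⌋≤pred : ∀ {m k} → suc (suc m) ≤ suc k → ⌊ suc (suc m) /2⌋ ≤ k
⌊n/2⌋≤pred {m} n≤1+k = ≤-trans (⌊n/2⌋≤⌈n/2⌉ (suc (suc m))) (⌈n/2⌉≤pred n≤1+k)

balanced-leaves : ∀ {k n} → 1 ≤ n → n ≤ k → leaves (balanced k n) ≡ n
balanced-leaves {n = zero} () _
balanced-leaves {zero} {suc _} _ ()
balanced-leaves {suc k} {suc zero} _ _ = refl
balanced-leaves {suc k} {n@(suc (suc _))} _ n≤1+k =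
  trans (cong₂ _+_ (balanced-leaves (s≤s z≤n) (⌊n/2⌋≤pred n≤1+k)) (balanced-leaves (s≤s z≤n) (⌈n/2⌉≤pred n≤1+k)))
        (⌊n/2⌋+⌈n/2⌉≡n n)

colless-balanced : ∀ {k n} → n ≤ k → colless (balanced k n) ≡ minColless k n
colless-balanced {zero} _ = refl
colless-balanced {suc k} {zero} _ = refl
colless-balanced {suc k} {suc zero} _ = refl
colless-balanced {suc k} {n@(suc (suc _))} n≤1+k = begin
  absDiff (leaves l) (leaves r) + colless l + colless r
    ≡⟨ cong₂ (λ a b → absDiff a b + colless l + colless r)
         (balanced-leaves (s≤s z≤n) (⌊n/2⌋≤pred n≤1+k)) (balanced-leaves (s≤s z≤n) (⌈n/2⌉≤pred n≤1+k)) ⟩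
  absDiff ⌊ n /2⌋ ⌈ n /2⌉ + colless l + colless r
    ≡⟨ cong₂ (λ a b → absDiff ⌊ n /2⌋ ⌈ n /2⌉ + a + b)
         (colless-balanced (⌊n/2⌋≤pred n≤1+k)) (colless-balanced (⌈n/2⌉≤pred n≤1+k)) ⟩
  minColless (suc k) n ∎
  where
  open ≡-Reasoning
  l = balanced k ⌊ n /2⌋
  r = balanced k ⌈ n /2⌉

1≤leaves : ∀ T → 1 ≤ leaves T
1≤leaves leaf       = s≤s z≤n
1≤leaves (node a _) = ≤-trans (1≤leaves a) (m≤m+n _ _)

theorem7 : (Ta Tb : Tree) (c : ℕ) →
    leaves Ta ≢ leaves Tb → leaves Ta % 2 ≡ 1 → leaves Tb % 2 ≡ 1 →
    IsMinColless (leaves (node Ta Tb)) c →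
    c < colless (node Ta Tb)
theorem7 Ta Tb c x≢y x-odd y-odd (_ , minimal) = begin-strict
  c                                                ≤⟨ minimal (balanced K n) (balanced-leaves (1≤leaves (node Ta Tb)) (n≤1+n n)) ⟩
  colless (balanced K n)                           ≡⟨ colless-balanced (n≤1+n n) ⟩
  minColless K n                                   <⟨ minColless-odd-split n x≢y x-odd y-odd ⟩
  absDiff x y + minColless K x + minColless K y    ≤⟨ +-mono-≤ (+-monoʳ-≤ (absDiff x y) (minColless≤colless K Ta)) (minColless≤colless K Tb) ⟩
  colless (node Ta Tb)                             ∎
  where
  open ≤-Reasoning
  x = leaves Ta
  y = leaves Tb
  n = x + y
  K = suc n
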